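{- Let $n\ge 3$ and $k\ge 2$ be integers, and let $G_i=P_{2i+3}$ for all $i\in\{0,1,\ldots,n-2\}$. Suppose that for every choice of integers $n-1\ge i_1\ge i_2\ge\cdots\ge i_k\ge 0$, taking $G_{n-1}=C_{2n}$, we have $GR(G_{i_1},\ldots,G_{i_k})=|G_{i_1}|+\sum_{j=2}^k i_j$. Then for every choice of integers $n-1\ge i_1\ge i_2\ge\cdots\ge i_k\ge 0$, taking $G_{n-1}=P_{2n+1}$, we also have $GR(G_{i_1},\ldots,G_{i_k})=|G_{i_1}|+\sum_{j=2}^k i_j$.
   Context: $P_m$, $C_m$, $K_m$ denote the path, cycle and complete graph on $m$ vertices; $|H|$ is the number of vertices of a graph $H$. A Gallai coloring is a coloring of the edges of a complete graph with no rainbow triangle (a triangle whose three edges receive three distinct colors); a Gallai $k$-coloring is a Gallai coloring using at most $k$ colors (colors $1,\ldots,k$). For graphs $H_1,\ldots,H_k$, the Gallai-Ramsey number $GR(H_1,\ldots,H_k)$ is the least integer $N$ such that every Gallai $k$-coloring of $K_N$ contains, for some $i\in\{1,\ldots,k\}$, a copy of $H_i$ all of whose edges have color $i$. -}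

module Defs where

open import Data.Nat using (ℕ; zero; suc; _+_; _*_; _∸_; _≤_; _<_)
open import Data.Nat.Properties using (_≟_)
open import Data.Fin using (Fin; zero; suc; inject₁; fromℕ)
import Data.Fin as F
open import Data.Product using (Σ; _×_; _,_; proj₁)
open import Relation.Binary.PropositionalEquality using (_≡_; _≢_)
open import Relation.Nullary using (¬_; yes; no)
open import Function.Definitions using (Injective)

-- An edge coloring of K_N with colors Fin k (colors 1..k are encoded as 0..k-1).
-- A coloring is a function on ordered pairs that is required to be symmetric;
-- values on the diagonal are irrelevant.
Coloring : ℕ → ℕ → Set
Coloring N k = Fin N → Fin N → Fin k

Symmetric : ∀ {N k} → Coloring N k → Set
Symmetric {N} c = (a b : Fin N) → c a b ≡ c b a

RainbowTriangle : ∀ {N k} → Coloring N k → Set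
RainbowTriangle {N} c = Σ (Fin N) λ a → Σ (Fin N) λ b → Σ (Fin N) λ d →
  (a ≢ b) × (b ≢ d) × (a ≢ d) ×
  (c a b ≢ c b d) × (c b d ≢ c a d) × (c a b ≢ c a d)

GallaiColoring : ℕ → ℕ → Set
GallaiColoring N k = Σ (Coloring N k) λ c → Symmetric c × ¬ RainbowTriangle c

data Shape : Set where
  path  : ℕ → Shape
  cycle : ℕ → Shape

order : Shape → ℕ
order (path m)  = m
order (cycle m) = m

MonoPath : ∀ {N k} → Coloring N k → Fin k → ℕ → Set
MonoPath {N} c i zero = Σ (Fin zero → Fin N) λ v → Injective _≡_ _≡_ v
MonoPath {N} c i (suc m) = Σ (Fin (suc m) → Fin N) λ v →
  Injective _≡_ _≡_ v × ((j : Fin m) → c (v (inject₁ j)) (v (suc j)) ≡ i)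

MonoCycle : ∀ {N k} → Coloring N k → Fin k → ℕ → Set
MonoCycle {N} c i zero = Σ (Fin zero → Fin N) λ v → Injective _≡_ _≡_ v
MonoCycle {N} c i (suc m) = Σ (Fin (suc m) → Fin N) λ v →
  Injective _≡_ _≡_ v × ((j : Fin m) → c (v (inject₁ j)) (v (suc j)) ≡ i)
    × (c (v (fromℕ m)) (v zero) ≡ i)

Contains : ∀ {N k} → Coloring N k → Fin k → Shape → Set
Contains c i (path m)  = MonoPath c i m
Contains c i (cycle m) = MonoCycle c i m

Arrows : (k : ℕ) → (Fin k → Shape) → ℕ → Set
Arrows k H N = (g : GallaiColoring N k) →
  Σ (Fin k) λ i → Contains (proj₁ g) i (H i)

IsGR : (k : ℕ) → (Fin k → Shape) → ℕ → Set
IsGR k H N = Arrows k H N × ((M : ℕ) → M < N → ¬ Arrows k H M)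

GC : ℕ → ℕ → Shape
GC n i with i ≟ n ∸ 1
... | yes _ = cycle (2 * n)
... | no _  = path (2 * i + 3)

GP : ℕ → ℕ → Shape
GP n i = path (2 * i + 3)

sumFin : (k : ℕ) → (Fin k → ℕ) → ℕ
sumFin zero f = 0
sumFin (suc k) f = f zero + sumFin k (λ j → f (suc j))

grValue : (ℕ → Shape) → (k : ℕ) → (Fin k → ℕ) → ℕ
grValue G zero is = 0
grValue G (suc k) is = order (G (is zero)) + sumFin k (λ j → is (suc j))

ValidSeq : ℕ → (k : ℕ) → (Fin k → ℕ) → Set
ValidSeq n k is = ((a b : Fin k) → a F.≤ b → is b ≤ is a) × ((j : Fin k) → is j ≤ n ∸ 1)

-- If i₁ < n − 1 the cycle never occurs and both statements coincide, so let i₁ = n − 1.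
-- Lower bound: split 2i₁ + 2 + i₂ + ⋯ + i_k vertices into blocks of sizes 2i₁ + 2, i₂, …, i_k
-- and colour each edge by the larger block index of its ends. This colouring is Gallai, and a
-- path in colour j would need 2i₁ + 3 vertices of block 1 (j = 1), resp. i_j + 1 vertices of
-- block j (j > 1), since every second vertex of such a path lies in block j.
-- Upper bound: a Gallai colouring of K_{N+1}, N = 2n + i₂ + ⋯ + i_k, restricts to K_N, which by
-- hypothesis contains the required path unless it contains a C_{2n} in a colour a with i_a = n − 1.
-- Label the cycle vertices a and every other vertex x by the colour of x v₀. The capacities 2n
-- for label a and i_b for b ≠ a add up to N, so some class overflows. An a-labelled vertex off
-- the cycle extends it to P_{2n+1}; so does any of i_b + 1 vertices labelled b that sends an
-- a-edge to the cycle. Otherwise no triangle x v_t v_{t+1} is rainbow, so all their edges to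
-- the cycle have colour b, and alternating them with i_b + 2 cycle vertices gives P_{2i_b+3}.

module Submission where

open import Defs
open import Algebra.Properties.CommutativeSemigroup using (xy∙z≈zy∙x)
open import Data.Nat using (ℕ; zero; suc; _+_; _*_; _∸_; _≤_; _<_; z≤n; s≤s; s≤s⁻¹; _<?_; pred)
open import Data.Nat.Properties
  using ( 1+n≰n; +-comm; +-assoc; +-suc; +-identityʳ; *-comm; *-suc; +-cancelˡ-≡; +-cancelʳ-≡
        ; ∸-cancelʳ-≡; +-∸-assoc; n∸n≡0; m+n∸n≡m; ≤-trans; ≤-reflexive; ≤-antisym; <-trans
        ; ≮⇒≥; <⇒≱; n<1+n; m≤m+n; m≤n*m; +-monoʳ-<; +-mono-<; ∸-monoˡ-<; m<n+o⇒m∸n<o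
        ; +-commutativeSemigroup )
  renaming (_≟_ to _≟ℕ_)
open import Data.Fin using (Fin; zero; suc; toℕ; fromℕ<; inject₁; inject≤; splitAt; join; _↑ˡ_; _↑ʳ_)
import Data.Fin as Fin
open import Data.Fin.Properties using (injective⇒≤; any?; all?; ¬∀⟶∃¬) renaming (_≟_ to _≟ᶠ_)
import Data.Fin.Properties as Finₚ
open import Data.Vec.Functional using (_∷_; updateAt)
open import Data.Vec.Functional.Properties using (updateAt-updates; updateAt-minimal)
open import Data.Product using (Σ; ∃-syntax; _×_; _,_; proj₁; proj₂)
import Data.Product as Product
open import Data.Sum using (_⊎_; inj₁; inj₂; [_,_]′)
import Data.Sum as Sum
open import Data.Empty using (⊥-elim)
open import Function using (_∘_)
open import Function.Definitions using (Injective)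
open import Relation.Binary.PropositionalEquality
open import Relation.Nullary using (¬_; Dec; yes; no; contradiction)

AtLeast : ∀ {N} → ℕ → (Fin N → Set) → Set
AtLeast {N} m P = Σ (Fin m → Fin N) λ g → Injective _≡_ _≡_ g × (∀ t → P (g t))

module _ {N : ℕ} where

  atLeast-zero : {P : Fin N → Set} → AtLeast 0 P
  atLeast-zero = (λ ()) , (λ {}) , (λ ())

  atLeast-cons : ∀ {m} {P : Fin (suc N) → Set} →
                 P zero → AtLeast m (λ x → P (suc x)) → AtLeast (suc m) P
  atLeast-cons {P = P} p₀ (g , g-inj , g-P) = g′ , g′-inj , g′-P
    where
      g′ : Fin _ → Fin (suc N)
      g′ zero    = zero
      g′ (suc t) = suc (g t)
      g′-inj : Injective _≡_ _≡_ g′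
      g′-inj {zero}  {zero}  _  = refl
      g′-inj {zero}  {suc _} ()
      g′-inj {suc _} {zero}  ()
      g′-inj {suc t} {suc u} e = cong suc (g-inj (Finₚ.suc-injective e))
      g′-P : ∀ t → P (g′ t)
      g′-P zero    = p₀
      g′-P (suc t) = g-P t

  atLeast-map : ∀ {M m} {P : Fin N → Set} {Q : Fin M → Set} (f : Fin N → Fin M) →
                Injective _≡_ _≡_ f → (∀ {x} → P x → Q (f x)) → AtLeast m P → AtLeast m Q
  atLeast-map f f-inj P⇒Q (g , g-inj , g-P) = f ∘ g , g-inj ∘ f-inj , P⇒Q ∘ g-P

  atLeast-weaken : ∀ {m} {P Q : Fin N → Set} → (∀ {x} → P x → Q x) → AtLeast m P → AtLeast m Q
  atLeast-weaken P⇒Q (g , g-inj , g-P) = g , g-inj , P⇒Q ∘ g-P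

  atLeast⇒≤ : ∀ {m s} {P : Fin N → Set} (π : ∀ {x} → P x → Fin s) →
              (∀ {x y} (p : P x) (q : P y) → π p ≡ π q → x ≡ y) → AtLeast m P → m ≤ s
  atLeast⇒≤ π π-inj (g , g-inj , g-P) = injective⇒≤ (λ e → g-inj (π-inj (g-P _) (g-P _) e))

  atLeast-avoids : ∀ {m} {P : Fin N → Set} (u : Fin m → Fin N) →
                   AtLeast (suc m) P → ∃[ x ] P x × (∀ s → u s ≢ x)
  atLeast-avoids u (g , g-inj , g-P) with all? (λ t → any? (λ s → u s ≟ᶠ g t))
  ... | yes covered = contradiction (injective⇒≤ preimage-inj) 1+n≰n
    where
      preimage-inj : Injective _≡_ _≡_ (λ t → proj₁ (covered t))
      preimage-inj {t} {t′} e =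
        g-inj (trans (sym (proj₂ (covered t))) (trans (cong u e) (proj₂ (covered t′))))
  ... | no ¬covered with ¬∀⟶∃¬ _ _ (λ t → any? (λ s → u s ≟ᶠ g t)) ¬covered
  ...   | t , missed = g t , g-P t , λ s e → missed (s , e)

atLeast-suc : ∀ {N m} {P : Fin (suc N) → Set} → AtLeast m (λ x → P (suc x)) → AtLeast m P
atLeast-suc {P = P} = atLeast-map {Q = P} suc Finₚ.suc-injective (λ p → p)

atLeast-pair : ∀ {N m} {P : Fin (suc (suc N)) → Set} →
               P zero ⊎ P (suc zero) → AtLeast m (λ x → P (suc (suc x))) → AtLeast (suc m) P
atLeast-pair {P = P} (inj₁ p₀) rest = atLeast-cons {P = P} p₀ (atLeast-suc {P = λ x → P (suc x)} rest)
atLeast-pair {P = P} (inj₂ p₁) rest = atLeast-suc {P = P} (atLeast-cons {P = λ x → P (suc x)} p₁ rest)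

-- Each of the q+1 disjoint edges {2t, 2t+1} of the path 0 − 1 − ⋯ − (2q+1) contributes its own element.
atLeast-edgeCover : ∀ q {P : Fin (suc q * 2) → Set} →
                    ((j : Fin (suc (q * 2))) → P (inject₁ j) ⊎ P (suc j)) → AtLeast (suc q) P
atLeast-edgeCover zero    {P} cover =
  atLeast-pair {P = P} (cover zero) (atLeast-zero {P = λ x → P (suc (suc x))})
atLeast-edgeCover (suc q) {P} cover =
  atLeast-pair {P = P} (cover zero) (atLeast-edgeCover q {λ x → P (suc (suc x))} (λ j → cover (suc (suc j))))

sumFin-updateAt : ∀ k (ws : Fin k → ℕ) a (f : ℕ → ℕ) →
                  sumFin k (updateAt ws a f) + ws a ≡ sumFin k ws + f (ws a)
sumFin-updateAt (suc k) ws zero f =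
  xy∙z≈zy∙x +-commutativeSemigroup (f (ws zero)) (sumFin k (ws ∘ suc)) (ws zero)
sumFin-updateAt (suc k) ws (suc a) f = begin
  (ws zero + S′) + ws (suc a)   ≡⟨ +-assoc (ws zero) S′ (ws (suc a)) ⟩
  ws zero + (S′ + ws (suc a))   ≡⟨ cong (ws zero +_) (sumFin-updateAt k (ws ∘ suc) a f) ⟩
  ws zero + (S + f (ws (suc a))) ≡⟨ +-assoc (ws zero) S (f (ws (suc a))) ⟨
  (ws zero + S) + f (ws (suc a)) ∎
  where
    open ≡-Reasoning
    S  = sumFin k (ws ∘ suc)
    S′ = sumFin k (updateAt (ws ∘ suc) a f)

pigeonhole-weighted : ∀ {k} m (col : Fin m → Fin k) (ws : Fin k → ℕ) →
                      sumFin k ws < m → ∃[ a ] AtLeast (suc (ws a)) (λ x → col x ≡ a)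
pigeonhole-weighted {k} (suc m) col ws S<m with ws (col zero) in ws-a₀
... | zero = col zero , subst (λ v → AtLeast (suc v) (λ x → col x ≡ col zero)) (sym ws-a₀)
                            (atLeast-cons {P = λ x → col x ≡ col zero} refl
                                          (atLeast-zero {P = λ x → col (suc x) ≡ col zero}))
... | suc w with pigeonhole-weighted m (col ∘ suc) ws′ S′<m
  where
    ws′ = updateAt ws (col zero) pred
    S′ = sumFin k ws′
    1+S′≡S : suc S′ ≡ sumFin k ws
    1+S′≡S = +-cancelʳ-≡ w _ _ (begin
      suc S′ + w                          ≡⟨ +-suc S′ w ⟨
      S′ + suc w                          ≡⟨ cong (S′ +_) ws-a₀ ⟨
      S′ + ws (col zero)                  ≡⟨ sumFin-updateAt k ws (col zero) pred ⟩
      sumFin k ws + pred (ws (col zero))  ≡⟨ cong (λ v → sumFin k ws + pred v) ws-a₀ ⟩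
      sumFin k ws + w                     ∎)
      where open ≡-Reasoning
    S′<m : S′ < m
    S′<m = s≤s⁻¹ (subst (_< suc m) (sym 1+S′≡S) S<m)
...   | a , more with a ≟ᶠ col zero
...     | yes refl = a , subst (λ v → AtLeast v (λ x → col x ≡ a)) (cong suc (sym ws-a₀))
                           (atLeast-cons {P = λ x → col x ≡ a} refl
                             (subst (λ v → AtLeast (suc v) (λ x → col (suc x) ≡ a)) shrunk more))
  where
    shrunk : updateAt ws a pred a ≡ w
    shrunk = trans (updateAt-updates a ws) (cong pred ws-a₀)
...     | no a≢a₀ = a , atLeast-suc {P = λ x → col x ≡ a}
                          (subst (λ v → AtLeast (suc v) (λ x → col (suc x) ≡ a))
                                 (updateAt-minimal a (col zero) ws a≢a₀) more)

module _ {M N k : ℕ} (f : Fin M → Fin N) (f-inj : Injective _≡_ _≡_ f) where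

  restrictGallai : GallaiColoring N k → GallaiColoring M k
  restrictGallai (c , c-sym , c-gallai) =
    (λ x y → c (f x) (f y)) , (λ x y → c-sym (f x) (f y)) ,
    λ (a , b , d , a≢b , b≢d , a≢d , rainbow) →
      c-gallai (f a , f b , f d , a≢b ∘ f-inj , b≢d ∘ f-inj , a≢d ∘ f-inj , rainbow)

  liftContains : ∀ {c : Coloring N k} {i} H → Contains (λ x y → c (f x) (f y)) i H → Contains c i H
  liftContains (path zero)     (v , v-inj)                 = f ∘ v , v-inj ∘ f-inj
  liftContains (path (suc m))  (v , v-inj , edges)         = f ∘ v , v-inj ∘ f-inj , edges
  liftContains (cycle zero)    (v , v-inj)                 = f ∘ v , v-inj ∘ f-inj
  liftContains (cycle (suc m)) (v , v-inj , edges , close) = f ∘ v , v-inj ∘ f-inj , edges , close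

arrows-mono : ∀ {k H M N} → M ≤ N → Arrows k H M → Arrows k H N
arrows-mono {H = H} M≤N arrows g =
  let i , h = arrows (restrictGallai embed embed-inj g) in i , liftContains embed embed-inj (H i) h
  where
    embed : Fin _ → Fin _
    embed x = inject≤ x M≤N
    embed-inj : Injective _≡_ _≡_ embed
    embed-inj = Finₚ.inject≤-injective M≤N M≤N _ _

arrows-cong : ∀ {k H H′ N} → (∀ j → H j ≡ H′ j) → Arrows k H N → Arrows k H′ N
arrows-cong H≗H′ arrows g =
  let i , h = arrows g in i , subst (Contains (proj₁ g) i) (H≗H′ i) h

module MaxColouring {N k : ℕ} (label : Fin N → Fin k) where

  open import Algebra.Construct.NaturalChoice.Max (Finₚ.≤-totalOrder k)
    using (_⊔_; ⊔-sel; ⊔-comm; x≤y⇒x⊔y≈y; x≤y⇒y⊔x≈y; x≤x⊔y; x≤y⊔x)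

  two-maxima-agree : ∀ x y z → x ⊔ y ≡ y ⊔ z ⊎ y ⊔ z ≡ x ⊔ z ⊎ x ⊔ y ≡ x ⊔ z
  two-maxima-agree x y z with Finₚ.≤-total (x ⊔ y) z
  ... | inj₁ x⊔y≤z = inj₂ (inj₁ (trans (x≤y⇒x⊔y≈y (Finₚ.≤-trans (x≤y⊔x x y) x⊔y≤z))
                                       (sym (x≤y⇒x⊔y≈y (Finₚ.≤-trans (x≤x⊔y x y) x⊔y≤z)))))
  ... | inj₂ z≤x⊔y with ⊔-sel x y
  ...   | inj₁ x⊔y≡x = inj₂ (inj₂ (trans x⊔y≡x
                                     (sym (x≤y⇒y⊔x≈y (subst (z Fin.≤_) x⊔y≡x z≤x⊔y)))))
  ...   | inj₂ x⊔y≡y = inj₁ (trans x⊔y≡y (sym (x≤y⇒y⊔x≈y (subst (z Fin.≤_) x⊔y≡y z≤x⊔y))))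

  colouring : GallaiColoring N k
  colouring = c , (λ x y → ⊔-comm (label x) (label y)) , no-rainbow
    where
      c : Coloring N k
      c x y = label x ⊔ label y
      no-rainbow : ¬ RainbowTriangle c
      no-rainbow (a , b , d , _ , _ , _ , ab≢bd , bd≢ad , ab≢ad)
        with two-maxima-agree (label a) (label b) (label d)
      ... | inj₁ e        = ab≢bd e
      ... | inj₂ (inj₁ e) = bd≢ad e
      ... | inj₂ (inj₂ e) = ab≢ad e

  private
    c = proj₁ colouring

  edge-label : ∀ {x y j} → c x y ≡ j → label x ≡ j ⊎ label y ≡ j
  edge-label {x} {y} refl with ⊔-sel (label x) (label y)
  ... | inj₁ e = inj₁ (sym e)
  ... | inj₂ e = inj₂ (sym e)

  path-labels : ∀ {j} q → MonoPath c j (suc (suc q * 2)) → AtLeast (suc q) (λ x → label x ≡ j)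
  path-labels {j} q (v , v-inj , edges) =
    atLeast-map {Q = λ x → label x ≡ j} (v ∘ inject₁) (Finₚ.inject₁-injective ∘ v-inj) (λ p → p)
      (atLeast-edgeCover q {λ t → label (v (inject₁ t)) ≡ j} (λ t → edge-label (edges (inject₁ t))))

  edge-bound : ∀ {x y j} → c x y ≡ j → label x Fin.≤ j × label y Fin.≤ j
  edge-bound {x} {y} refl = x≤x⊔y (label x) (label y) , x≤y⊔x (label x) (label y)

  path-bounded : ∀ {j} m → MonoPath c j (suc (suc m)) → AtLeast (suc (suc m)) (λ x → label x Fin.≤ j)
  path-bounded m (v , v-inj , edges) = v , v-inj , bounded
    where
      bounded : ∀ t → label (v t) Fin.≤ _
      bounded zero    = proj₁ (edge-bound (edges zero))
      bounded (suc t) = proj₂ (edge-bound (edges t))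

blockOf : ∀ {k} (s : Fin k → ℕ) → Fin (sumFin k s) → Σ (Fin k) (λ j → Fin (s j))
blockOf {suc k} s x =
  [ (λ p → zero , p) , (λ y → let j , p = blockOf (s ∘ suc) y in suc j , p) ]′ (splitAt (s zero) x)

fromBlock : ∀ {k} (s : Fin k → ℕ) → Σ (Fin k) (λ j → Fin (s j)) → Fin (sumFin k s)
fromBlock s (zero  , p) = p ↑ˡ _
fromBlock s (suc j , p) = s zero ↑ʳ fromBlock (s ∘ suc) (j , p)

fromBlock-blockOf : ∀ {k} (s : Fin k → ℕ) x → fromBlock s (blockOf s x) ≡ x
fromBlock-blockOf {suc k} s x with splitAt (s zero) x in split
... | inj₁ p = trans (cong (join _ _) (sym split)) (Finₚ.join-splitAt (s zero) _ x)
... | inj₂ y = trans (cong (s zero ↑ʳ_) (fromBlock-blockOf (s ∘ suc) y))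
                     (trans (cong (join _ _) (sym split)) (Finₚ.join-splitAt (s zero) _ x))

blockOf-injective : ∀ {k} (s : Fin k → ℕ) → Injective _≡_ _≡_ (blockOf s)
blockOf-injective s {x} {y} e =
  trans (sym (fromBlock-blockOf s x)) (trans (cong (fromBlock s) e) (fromBlock-blockOf s y))

block-size : ∀ {k m} (s : Fin k → ℕ) {j} → AtLeast m (λ x → proj₁ (blockOf s x) ≡ j) → m ≤ s j
block-size s {j} members = atLeast⇒≤ proj₁ same-position (atLeast-weaken (λ {x} → position {x}) members)
  where
    InBlock : Fin (sumFin _ s) → Set
    InBlock x = Σ (Fin (s j)) λ p → blockOf s x ≡ (j , p)
    position : ∀ {x} → proj₁ (blockOf s x) ≡ j → InBlock x
    position {x} refl = proj₂ (blockOf s x) , refl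
    same-position : ∀ {x y} (p : InBlock x) (q : InBlock y) → proj₁ p ≡ proj₁ q → x ≡ y
    same-position (p , e) (.p , e′) refl = blockOf-injective s (trans e (sym e′))

2q+3≡suc[suc[q]*2] : ∀ q → 2 * q + 3 ≡ suc (suc q * 2)
2q+3≡suc[suc[q]*2] q = trans (+-comm (2 * q) 3) (cong (3 +_) (*-comm 2 q))

paths-lowerBound : ∀ {k M} (is : Fin (suc k) → ℕ) → M < (2 * is zero + 3) + sumFin k (is ∘ suc) →
                   ¬ Arrows (suc k) (λ j → path (2 * is j + 3)) M
paths-lowerBound {k} {M} is M<value arrows =
  let j , p = arrows-mono {H = λ j → path (2 * is j + 3)} M≤total arrows colouring
  in  no-path j (subst (MonoPath c j) (2q+3≡suc[suc[q]*2] (is j)) p)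
  where
    M≤total : M ≤ suc (is zero) * 2 + sumFin k (is ∘ suc)
    M≤total = s≤s⁻¹ (subst (M <_) (cong (_+ sumFin k (is ∘ suc)) (2q+3≡suc[suc[q]*2] (is zero))) M<value)
    sizes : Fin (suc k) → ℕ
    sizes zero    = suc (is zero) * 2
    sizes (suc j) = is (suc j)
    open MaxColouring (proj₁ ∘ blockOf sizes)
    c = proj₁ colouring
    no-path : ∀ j → ¬ MonoPath c j (suc (suc (is j) * 2))
    no-path zero    p =
      1+n≰n (block-size sizes (atLeast-weaken (λ {x} → ≤zero⇒≡zero {x}) (path-bounded _ p)))
      where
        ≤zero⇒≡zero : ∀ {x} → proj₁ (blockOf sizes x) Fin.≤ zero {k} → proj₁ (blockOf sizes x) ≡ zero
        ≤zero⇒≡zero ≤zero = Finₚ.≤-antisym ≤zero z≤n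
    no-path (suc j) p = 1+n≰n (block-size sizes (path-labels (is (suc j)) p))

module CyclicShift (p : ℕ) where

  shiftℕ : ℕ → ℕ → ℕ
  shiftℕ s t with s + t <? suc p
  ... | yes _ = s + t
  ... | no  _ = s + t ∸ suc p

  shiftℕ-< : ∀ {s t} → s < suc p → t < suc p → shiftℕ s t < suc p
  shiftℕ-< {s} {t} s<P t<P with s + t <? suc p
  ... | yes s+t<P = s+t<P
  ... | no  _      = m<n+o⇒m∸n<o (s + t) (suc p) (+-mono-< s<P t<P)

  shiftℕ-zero : ∀ {s} → s < suc p → shiftℕ s 0 ≡ s
  shiftℕ-zero {s} s<P with s + 0 <? suc p
  ... | yes _     = +-identityʳ s
  ... | no  s≮P   = contradiction (subst (_< suc p) (sym (+-identityʳ s)) s<P) s≮P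

  private
    wrapped-< : ∀ s {t} → t < suc p → suc p ≤ s + t → s + t ∸ suc p < s
    wrapped-< s {t} t<P P≤s+t =
      subst (s + t ∸ suc p <_) (m+n∸n≡m s (suc p)) (∸-monoˡ-< (+-monoʳ-< s t<P) P≤s+t)

  shiftℕ-injective : ∀ s {t t′} → t < suc p → t′ < suc p → shiftℕ s t ≡ shiftℕ s t′ → t ≡ t′
  shiftℕ-injective s {t} {t′} t<P t′<P e with s + t <? suc p | s + t′ <? suc p
  ... | yes _   | yes _   = +-cancelˡ-≡ s _ _ e
  ... | no  ≮P  | no  ≮P′ = +-cancelˡ-≡ s _ _ (∸-cancelʳ-≡ (≮⇒≥ ≮P) (≮⇒≥ ≮P′) e)
  ... | yes _   | no  ≮P′ =
    contradiction (subst (s ≤_) e (m≤m+n s t)) (<⇒≱ (wrapped-< s t′<P (≮⇒≥ ≮P′)))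
  ... | no  ≮P  | yes _   =
    contradiction (subst (s ≤_) (sym e) (m≤m+n s t′)) (<⇒≱ (wrapped-< s t<P (≮⇒≥ ≮P)))

  shiftℕ-suc : ∀ s t → shiftℕ s (suc t) ≡ suc (shiftℕ s t) ⊎ (shiftℕ s t ≡ p × shiftℕ s (suc t) ≡ 0)
  shiftℕ-suc s t with s + t <? suc p | s + suc t <? suc p
  ... | yes _    | yes _    = inj₁ (+-suc s t)
  ... | yes <P   | no  ≮P′  =
    inj₂ (s+t≡p , trans (cong (_∸ suc p) (+-suc s t)) (trans (cong (_∸ p) s+t≡p) (n∸n≡0 p)))
    where
      s+t≡p : s + t ≡ p
      s+t≡p = ≤-antisym (s≤s⁻¹ <P) (s≤s⁻¹ (subst (suc p ≤_) (+-suc s t) (≮⇒≥ ≮P′)))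
  ... | no  ≮P   | yes <P′  =
    contradiction (<-trans (subst (s + t <_) (sym (+-suc s t)) (n<1+n (s + t))) <P′) ≮P
  ... | no  ≮P   | no  _    = inj₁ (trans (cong (_∸ suc p) (+-suc s t)) (+-∸-assoc 1 (≮⇒≥ ≮P)))

  CyclicSucc : Fin (suc p) → Fin (suc p) → Set
  CyclicSucc a b = toℕ b ≡ suc (toℕ a) ⊎ (toℕ a ≡ p × toℕ b ≡ 0)

  shift : Fin (suc p) → Fin (suc p) → Fin (suc p)
  shift s t = fromℕ< (shiftℕ-< (Finₚ.toℕ<n s) (Finₚ.toℕ<n t))

  toℕ-shift : ∀ s t → toℕ (shift s t) ≡ shiftℕ (toℕ s) (toℕ t)
  toℕ-shift s t = Finₚ.toℕ-fromℕ< _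

  shift-zero : ∀ s → shift s zero ≡ s
  shift-zero s = Finₚ.toℕ-injective (trans (toℕ-shift s zero) (shiftℕ-zero (Finₚ.toℕ<n s)))

  shift-injective : ∀ s → Injective _≡_ _≡_ (shift s)
  shift-injective s {t} {t′} e = Finₚ.toℕ-injective
    (shiftℕ-injective (toℕ s) (Finₚ.toℕ<n t) (Finₚ.toℕ<n t′)
      (trans (sym (toℕ-shift s t)) (trans (cong toℕ e) (toℕ-shift s t′))))

  toℕ-shift-inject₁ : ∀ s (t : Fin p) → toℕ (shift s (inject₁ t)) ≡ shiftℕ (toℕ s) (toℕ t)
  toℕ-shift-inject₁ s t =
    trans (toℕ-shift s (inject₁ t)) (cong (shiftℕ (toℕ s)) (Finₚ.toℕ-inject₁ t))

  shift-succ : ∀ s (t : Fin p) → CyclicSucc (shift s (inject₁ t)) (shift s (suc t))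
  shift-succ s t with shiftℕ-suc (toℕ s) (toℕ t)
  ... | inj₁ e         =
    inj₁ (trans (toℕ-shift s (suc t)) (trans e (cong suc (sym (toℕ-shift-inject₁ s t)))))
  ... | inj₂ (e₁ , e₂) = inj₂ (trans (toℕ-shift-inject₁ s t) e₁ , trans (toℕ-shift s (suc t)) e₂)

module _ {N k : ℕ} {c : Coloring N k} {i : Fin k} where

  cycle-edge : ∀ {p} (C : MonoCycle c i (suc p)) {a b} →
               CyclicShift.CyclicSucc p a b → c (proj₁ C a) (proj₁ C b) ≡ i
  cycle-edge {p} (v , _ , edges , _) {a} {b} (inj₁ b≡1+a) =
    subst₂ (λ a b → c (v a) (v b) ≡ i) inject₁-a′≡a suc-a′≡b (edges a′)
    where
      a<p : toℕ a < p
      a<p = s≤s⁻¹ (subst (_< suc p) b≡1+a (Finₚ.toℕ<n b))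
      a′ = fromℕ< a<p
      inject₁-a′≡a : inject₁ a′ ≡ a
      inject₁-a′≡a = Finₚ.toℕ-injective (trans (Finₚ.toℕ-inject₁ a′) (Finₚ.toℕ-fromℕ< a<p))
      suc-a′≡b : suc a′ ≡ b
      suc-a′≡b = Finₚ.toℕ-injective (trans (cong suc (Finₚ.toℕ-fromℕ< a<p)) (sym b≡1+a))
  cycle-edge {p} (v , _ , _ , close) (inj₂ (a≡p , b≡0)) =
    subst₂ (λ a b → c (v a) (v b) ≡ i)
      (Finₚ.toℕ-injective (trans (Finₚ.toℕ-fromℕ p) (sym a≡p)))
      (Finₚ.toℕ-injective (sym b≡0))
      close

  rotatedPath : ∀ {p} → MonoCycle c i (suc p) → Fin (suc p) → MonoPath c i (suc p)
  rotatedPath {p} C@(v , v-inj , _) s =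
    v ∘ shift s , shift-injective s ∘ v-inj , λ t → cycle-edge C (shift-succ s t)
    where open CyclicShift p

  extendPath : ∀ {m} x (P : MonoPath c i (suc m)) → (∀ t → proj₁ P t ≢ x) → c x (proj₁ P zero) ≡ i →
               MonoPath c i (suc (suc m))
  extendPath x (v , v-inj , edges) x∉P x~P₀ = x ∷ v , injective , edge
    where
      injective : Injective _≡_ _≡_ (x ∷ v)
      injective {zero}  {zero}   _ = refl
      injective {zero}  {suc t}  e = ⊥-elim (x∉P t (sym e))
      injective {suc t} {zero}   e = ⊥-elim (x∉P t e)
      injective {suc t} {suc t′} e = cong suc (v-inj e)
      edge : ∀ j → c ((x ∷ v) (inject₁ j)) ((x ∷ v) (suc j)) ≡ i
      edge zero    = x~P₀
      edge (suc j) = edges j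

module _ {N k : ℕ} {c : Coloring N k} (c-gallai : ¬ RainbowTriangle c) where

  triangle-twoColours : ∀ {x y z} → x ≢ y → y ≢ z → x ≢ z → c x y ≢ c y z →
                        c x z ≡ c x y ⊎ c x z ≡ c y z
  triangle-twoColours {x} {y} {z} x≢y y≢z x≢z xy≢yz with c x z ≟ᶠ c x y | c x z ≟ᶠ c y z
  ... | yes e  | _      = inj₁ e
  ... | no _   | yes e  = inj₂ e
  ... | no xz≢xy | no xz≢yz =
    ⊥-elim (c-gallai (x , y , z , x≢y , y≢z , x≢z , xy≢yz , xz≢yz ∘ sym , xz≢xy ∘ sym))

  -- Along each edge of the path, the triangle it spans with x cannot be rainbow.
  sameColour-toPath : ∀ {i m x} (P : MonoPath c i (suc m)) → (∀ t → proj₁ P t ≢ x) →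
                      (∀ t → c x (proj₁ P t) ≢ i) → ∀ t → c x (proj₁ P t) ≡ c x (proj₁ P zero)
  sameColour-toPath             _                    _   _   zero    = refl
  sameColour-toPath {m = suc m} {x} (v , v-inj , edges) x∉P x≁P (suc t) =
    trans (sameColour-toPath (v ∘ suc , Finₚ.suc-injective ∘ v-inj , edges ∘ suc) (x∉P ∘ suc) (x≁P ∘ suc) t)
          first-step
    where
      first-step : c x (v (suc zero)) ≡ c x (v zero)
      first-step with triangle-twoColours (x∉P zero ∘ sym) (Finₚ.0≢1+n ∘ v-inj) (x∉P (suc zero) ∘ sym)
                                          (λ e → x≁P zero (trans e (edges zero)))
      ... | inj₁ e = e
      ... | inj₂ e = ⊥-elim (x≁P (suc zero) (trans e (edges zero)))

interleave : ∀ {A : Set} n → (Fin (suc n) → A) → (Fin n → A) → Fin (suc (n * 2)) → A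
interleave n       cy ou zero          = cy zero
interleave (suc n) cy ou (suc zero)    = ou zero
interleave (suc n) cy ou (suc (suc t)) = interleave n (cy ∘ suc) (ou ∘ suc) t

module _ {A : Set} where

  interleave-image : ∀ n (cy : Fin (suc n) → A) ou t →
                     (∃[ r ] interleave n cy ou t ≡ cy r) ⊎ (∃[ r ] interleave n cy ou t ≡ ou r)
  interleave-image n       cy ou zero          = inj₁ (zero , refl)
  interleave-image (suc n) cy ou (suc zero)    = inj₂ (zero , refl)
  interleave-image (suc n) cy ou (suc (suc t)) =
    Sum.map (Product.map suc (λ e → e)) (Product.map suc (λ e → e))
            (interleave-image n (cy ∘ suc) (ou ∘ suc) t)

  interleave-injective : ∀ n {cy : Fin (suc n) → A} {ou} → Injective _≡_ _≡_ cy → Injective _≡_ _≡_ ou →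
                         (∀ r r′ → cy r ≢ ou r′) → Injective _≡_ _≡_ (interleave n cy ou)
  interleave-injective n cy-inj ou-inj disjoint {zero} {zero} _ = refl
  interleave-injective (suc n) {cy} {ou} cy-inj ou-inj disjoint = injective
    where
      rest = interleave n (cy ∘ suc) (ou ∘ suc)
      avoids-rest : ∀ {x} → (∀ r → x ≢ cy (suc r)) → (∀ r → x ≢ ou (suc r)) → ∀ t → x ≢ rest t
      avoids-rest x∉cy x∉ou t e with interleave-image n (cy ∘ suc) (ou ∘ suc) t
      ... | inj₁ (r , e′) = x∉cy r (trans e e′)
      ... | inj₂ (r , e′) = x∉ou r (trans e e′)
      cy₀∉rest : ∀ t → cy zero ≢ rest t
      cy₀∉rest = avoids-rest (λ r → Finₚ.0≢1+n ∘ cy-inj) (λ r → disjoint zero (suc r))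
      ou₀∉rest : ∀ t → ou zero ≢ rest t
      ou₀∉rest = avoids-rest (λ r e → disjoint (suc r) zero (sym e)) (λ r → Finₚ.0≢1+n ∘ ou-inj)
      injective : Injective _≡_ _≡_ (interleave (suc n) cy ou)
      injective {zero}        {zero}         _ = refl
      injective {zero}        {suc zero}     e = ⊥-elim (disjoint zero zero e)
      injective {suc zero}    {zero}         e = ⊥-elim (disjoint zero zero (sym e))
      injective {suc zero}    {suc zero}     _ = refl
      injective {zero}        {suc (suc t)}  e = ⊥-elim (cy₀∉rest t e)
      injective {suc (suc t)} {zero}         e = ⊥-elim (cy₀∉rest t (sym e))
      injective {suc zero}    {suc (suc t)}  e = ⊥-elim (ou₀∉rest t e)
      injective {suc (suc t)} {suc zero}     e = ⊥-elim (ou₀∉rest t (sym e))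
      injective {suc (suc t)} {suc (suc t′)} e =
        cong (λ t → suc (suc t))
          (interleave-injective n (Finₚ.suc-injective ∘ cy-inj) (Finₚ.suc-injective ∘ ou-inj)
                                (λ r r′ → disjoint (suc r) (suc r′)) {t} {t′} e)

module _ {N k : ℕ} {c : Coloring N k} {a : Fin k} where

  interleave-edges : ∀ n {cy : Fin (suc n) → Fin N} {ou} →
                     (∀ r r′ → c (cy r) (ou r′) ≡ a) → (∀ r r′ → c (ou r′) (cy r) ≡ a) →
                     ∀ j → c (interleave n cy ou (inject₁ j)) (interleave n cy ou (suc j)) ≡ a
  interleave-edges (suc n) cy~ou ou~cy zero          = cy~ou zero zero
  interleave-edges (suc n) cy~ou ou~cy (suc zero)    = ou~cy (suc zero) zero
  interleave-edges (suc n) cy~ou ou~cy (suc (suc j)) =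
    interleave-edges n (λ r r′ → cy~ou (suc r) (suc r′)) (λ r r′ → ou~cy (suc r) (suc r′)) j

  alternatingPath : ∀ n (cy : Fin (suc n) → Fin N) (ou : Fin n → Fin N) →
                    Injective _≡_ _≡_ cy → Injective _≡_ _≡_ ou → (∀ r r′ → cy r ≢ ou r′) →
                    (∀ r r′ → c (cy r) (ou r′) ≡ a) → (∀ r r′ → c (ou r′) (cy r) ≡ a) →
                    MonoPath c a (suc (n * 2))
  alternatingPath n cy ou cy-inj ou-inj disjoint cy~ou ou~cy =
    interleave n cy ou , interleave-injective n cy-inj ou-inj disjoint , interleave-edges n cy~ou ou~cy

module CycleExtension {N k p : ℕ} (g : GallaiColoring N k) {i : Fin k} (C : MonoCycle (proj₁ g) i (suc p)) where

  private
    c = proj₁ g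
    v = proj₁ C
    v-inj = proj₁ (proj₂ C)
    cyclePath : MonoPath c i (suc p)
    cyclePath = v , v-inj , proj₁ (proj₂ (proj₂ C))

  label : Fin N → Fin k
  label x with any? (λ s → v s ≟ᶠ x)
  ... | yes _ = i
  ... | no  _ = c x (v zero)

  label-onCycle : ∀ {s x} → v s ≡ x → label x ≡ i
  label-onCycle {s} {x} e with any? (λ s → v s ≟ᶠ x)
  ... | yes _ = refl
  ... | no  x∉C = contradiction (s , e) x∉C

  label-outside : ∀ {x} → (∀ s → v s ≢ x) → label x ≡ c x (v zero)
  label-outside {x} x∉C with any? (λ s → v s ≟ᶠ x)
  ... | yes (s , e) = contradiction e (x∉C s)
  ... | no  _       = refl

  longPath : ∀ x → (∀ s → v s ≢ x) → ∀ s → c x (v s) ≡ i → MonoPath c i (suc (suc p))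
  longPath x x∉C s x~vₛ =
    extendPath {c = c} x (rotatedPath {c = c} C s) (x∉C ∘ shift s)
               (subst (λ t → c x (v t) ≡ i) (sym (shift-zero s)) x~vₛ)
    where open CyclicShift p

  overfull-ownClass : AtLeast (suc (suc p)) (λ x → label x ≡ i) → MonoPath c i (suc (suc p))
  overfull-ownClass class =
    let x , x-i , x∉C = atLeast-avoids {P = λ x → label x ≡ i} v class
    in  longPath x x∉C zero (trans (sym (label-outside x∉C)) x-i)

  foreignClass : ∀ {a q} → a ≢ i → suc (suc q) ≤ suc p → AtLeast (suc q) (λ x → label x ≡ a) →
                 MonoPath c i (suc (suc p)) ⊎ MonoPath c a (suc (suc q * 2))
  foreignClass {a} {q} a≢i q+2≤P (w , w-inj , w-a) with any? (λ t → any? (λ s → c (w t) (v s) ≟ᶠ i))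
  ... | yes (t , s , e) = inj₁ (longPath (w t) (outside t) s e)
    where
      outside : ∀ t s → v s ≢ w t
      outside t s e = a≢i (trans (sym (w-a t)) (label-onCycle e))
  ... | no none =
    inj₂ (alternatingPath {c = c} (suc q) (v ∘ embed) w (Finₚ.inject≤-injective _ _ _ _ ∘ v-inj) w-inj
                          (λ r t → outside t (embed r))
                          (λ r t → trans (proj₁ (proj₂ g) _ _) (sees-a t (embed r)))
                          (λ r t → sees-a t (embed r)))
    where
      embed : Fin (suc (suc q)) → Fin (suc p)
      embed r = inject≤ r q+2≤P
      outside : ∀ t s → v s ≢ w t
      outside t s e = a≢i (trans (sym (w-a t)) (label-onCycle e))
      sees-a : ∀ t s → c (w t) (v s) ≡ a
      sees-a t s =
        trans (sameColour-toPath (proj₂ (proj₂ g)) cyclePath (outside t) (λ s e → none (t , s , e)) s)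
              (trans (sym (label-outside (outside t))) (w-a t))

  -- Colour i may absorb all suc p cycle vertices, any other colour b only is b vertices.
  someMonoPath : (is : Fin k → ℕ) → 2 * is i + 3 ≡ suc (suc p) → (∀ b → suc (suc (is b)) ≤ suc p) →
          sumFin k (updateAt is i (λ _ → suc p)) < N → ∃[ b ] MonoPath c b (2 * is b + 3)
  someMonoPath is ownLength short big with pigeonhole-weighted N label (updateAt is i (λ _ → suc p)) big
  ... | a , class with a ≟ᶠ i
  ...   | yes refl = i , subst (MonoPath c i) (sym ownLength)
                           (overfull-ownClass (subst (λ w → AtLeast (suc w) (λ x → label x ≡ i))
                                                     (updateAt-updates i is) class))
  ...   | no a≢i with foreignClass a≢i (short a) (subst (λ w → AtLeast (suc w) (λ x → label x ≡ a))
                                                          (updateAt-minimal a i is a≢i) class)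
  ...     | inj₁ long = i , subst (MonoPath c i) (sym ownLength) long
  ...     | inj₂ zigzag = a , subst (MonoPath c a) (sym (2q+3≡suc[suc[q]*2] (is a))) zigzag

GC-≢ : ∀ n x → x ≢ n ∸ 1 → GC n x ≡ GP n x
GC-≢ n x x≢n-1 with x ≟ℕ n ∸ 1
... | yes e = contradiction e x≢n-1
... | no  _ = refl

GC-last : ∀ n → GC (suc n) n ≡ cycle (2 * suc n)
GC-last n with n ≟ℕ n
... | yes _ = refl
... | no n≢n = contradiction refl n≢n

upperBound-lastCycle : ∀ {n k} (is : Fin (suc k) → ℕ) → (∀ j → is j ≤ n) → is zero ≡ n →
  Arrows (suc k) (λ j → GC (suc n) (is j)) (grValue (GC (suc n)) (suc k) is) →
  Arrows (suc k) (λ j → GP (suc n) (is j)) (grValue (GP (suc n)) (suc k) is)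
upperBound-lastCycle {n} {k} is bounded refl arrows =
  subst (Arrows (suc k) (λ j → GP (suc n) (is j))) (sym value) upper
  where
    Σr = sumFin k (is ∘ suc)
    P = 2 * suc n
    N₀ = grValue (GC (suc n)) (suc k) is
    N₀≡P+Σr : N₀ ≡ P + Σr
    N₀≡P+Σr = cong (λ H → order H + Σr) (GC-last n)
    2n+3≡1+P : 2 * n + 3 ≡ suc P
    2n+3≡1+P = trans (2q+3≡suc[suc[q]*2] n) (cong suc (*-comm (suc n) 2))
    value : grValue (GP (suc n)) (suc k) is ≡ suc N₀
    value = trans (cong (_+ Σr) 2n+3≡1+P) (cong suc (sym N₀≡P+Σr))
    upper : Arrows (suc k) (λ j → GP (suc n) (is j)) (suc N₀)
    upper g = let a , h = arrows (restrictGallai inject₁ Finₚ.inject₁-injective g)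
              in  found a (liftContains inject₁ Finₚ.inject₁-injective (GC (suc n) (is a)) h) (is a ≟ℕ n)
      where
      found : ∀ a → Contains (proj₁ g) a (GC (suc n) (is a)) → Dec (is a ≡ n) →
              ∃[ b ] Contains (proj₁ g) b (GP (suc n) (is b))
      found a h (no isₐ≢n) = a , subst (Contains (proj₁ g) a) (GC-≢ (suc n) (is a) isₐ≢n) h
      found a h (yes isₐ≡n) = CycleExtension.someMonoPath g cyc is ownLength short big
        where
        cyc : MonoCycle (proj₁ g) a P
        cyc = subst (Contains (proj₁ g) a) (trans (cong (GC (suc n)) isₐ≡n) (GC-last n)) h
        ownLength : 2 * is a + 3 ≡ suc P
        ownLength = trans (cong (λ x → 2 * x + 3) isₐ≡n) 2n+3≡1+P
        short : ∀ b → suc (suc (is b)) ≤ P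
        short b = subst (suc (suc (is b)) ≤_) (sym (*-suc 2 n))
                        (s≤s (s≤s (≤-trans (bounded b) (m≤n*m n 2))))
        S′ = sumFin (suc k) (updateAt is a (λ _ → P))
        big : S′ < suc N₀
        big = s≤s (≤-reflexive (+-cancelʳ-≡ n S′ N₀ (begin
          S′ + n        ≡⟨ cong (S′ +_) isₐ≡n ⟨
          S′ + is a     ≡⟨ sumFin-updateAt (suc k) is a (λ _ → P) ⟩
          (n + Σr) + P  ≡⟨ xy∙z≈zy∙x +-commutativeSemigroup n Σr P ⟩
          (P + Σr) + n  ≡⟨ cong (_+ n) N₀≡P+Σr ⟨
          N₀ + n        ∎)))
          where open ≡-Reasoning

proposition1p14 : (n k : ℕ) → 3 ≤ n → 2 ≤ k →
    ((is : Fin k → ℕ) → ValidSeq n k is → IsGR k (λ j → GC n (is j)) (grValue (GC n) k is)) →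
    ((is : Fin k → ℕ) → ValidSeq n k is → IsGR k (λ j → GP n (is j)) (grValue (GP n) k is))
proposition1p14 zero    k       ()  _  _   _  _
proposition1p14 (suc n) zero    _   () _   _  _
proposition1p14 (suc n) (suc k) _   _  hyp is valid@(decreasing , bounded) = upper (is zero ≟ℕ n) , lower
  where
    C-arrows = proj₁ (hyp is valid)
    below-last : is zero ≢ n → ∀ j → is j ≢ n
    below-last is₀≢n j isⱼ≡n =
      is₀≢n (≤-antisym (bounded zero) (subst (_≤ is zero) isⱼ≡n (decreasing zero j z≤n)))
    upper : Dec (is zero ≡ n) → Arrows (suc k) (λ j → GP (suc n) (is j)) (grValue (GP (suc n)) (suc k) is)
    upper (yes is₀≡n) = upperBound-lastCycle is bounded is₀≡n C-arrows
    upper (no  is₀≢n) =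
      subst (Arrows (suc k) (λ j → GP (suc n) (is j)))
            (cong (λ H → order H + sumFin k (is ∘ suc)) (GC-≢ (suc n) (is zero) is₀≢n))
            (arrows-cong (λ j → GC-≢ (suc n) (is j) (below-last is₀≢n j)) C-arrows)
    lower : ∀ M → M < grValue (GP (suc n)) (suc k) is → ¬ Arrows (suc k) (λ j → GP (suc n) (is j)) M
    lower M = paths-lowerBound is
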